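{- Let $G$ be a connected edge-transitive graph that is not isomorphic to a star. Then every path in $G$ of length at most $3$ closes to a cycle. Moreover, for every integer $\ell\geq 4$, there exist infinitely many connected edge-transitive graphs each containing a path of length $\ell$ that does not close to a cycle.
   Context: All graphs are finite, simple and undirected, and graphs are considered up to isomorphism. A star is a complete bipartite graph $K_{1,n}$ for some $n\ge 0$. A graph is edge-transitive if for every two edges $e,f$ there is an automorphism mapping $e$ to $f$ (edges mapped via $\{x,y\}\mapsto\{\phi(x),\phi(y)\}$). A path of length $\ell$ in $G$ is a sequence $(x_0,\dots,x_\ell)$ of pairwise distinct vertices with $x_i x_{i+1}\in E(G)$ for $0\le i\le \ell-1$ (length $0$ means a single vertex). A cycle is a sequence $(x_0,\dots,x_{\ell-1},x_\ell=x_0)$ with $\ell\ge 3$, $x_0,\dots,x_{\ell-1}$ pairwise distinct and consecutive vertices adjacent. Paths and cycles are identified with the subgraphs formed by their vertices and edges. A path $P$ closes to a cycle if there is a cycle $C$ in $G$ with $P$ a subgraph of $C$. -}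

module Defs where

open import Data.Nat using (ℕ; zero; suc; _≤_; _<_)
open import Data.Fin using (Fin; zero; suc; toℕ; inject₁)
open import Data.Bool using (Bool; true; false)
open import Data.Product using (Σ; ∃; ∃-syntax; _×_; _,_)
open import Data.Sum using (_⊎_)
open import Relation.Binary.PropositionalEquality using (_≡_)
open import Function.Bundles using (_↔_; Inverse)
open import Function.Definitions using (Injective)

record Graph : Set where
  field
    n     : ℕ
    E     : Fin n → Fin n → Bool
    E-sym : ∀ x y → E x y ≡ E y x
    E-irr : ∀ x → E x x ≡ false
open Graph public

Adj : (G : Graph) → Fin (n G) → Fin (n G) → Set
Adj G x y = E G x y ≡ true

Iso : Graph → Graph → Set
Iso G H = Σ (Fin (n G) ↔ Fin (n H)) λ φ →
  ∀ x y → E G x y ≡ E H (Inverse.to φ x) (Inverse.to φ y)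

Aut : Graph → Set
Aut G = Iso G G

EdgeTransitive : Graph → Set
EdgeTransitive G = ∀ x y u v → Adj G x y → Adj G u v →
  Σ (Aut G) λ φ → let f = Inverse.to (Data.Product.proj₁ φ) in
    (f x ≡ u × f y ≡ v) ⊎ (f x ≡ v × f y ≡ u)

data Walk (G : Graph) : Fin (n G) → Fin (n G) → Set where
  here : ∀ {x} → Walk G x x
  step : ∀ {x y z} → Adj G x y → Walk G y z → Walk G x z

Connected : Graph → Set
Connected G = (0 < n G) × (∀ x y → Walk G x y)

starE : ∀ {k} → Fin (suc k) → Fin (suc k) → Bool
starE zero    zero    = false
starE zero    (suc _) = true
starE (suc _) zero    = true
starE (suc _) (suc _) = false

starE-sym : ∀ {k} (x y : Fin (suc k)) → starE x y ≡ starE y x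
starE-sym zero    zero    = _≡_.refl
starE-sym zero    (suc _) = _≡_.refl
starE-sym (suc _) zero    = _≡_.refl
starE-sym (suc _) (suc _) = _≡_.refl

starE-irr : ∀ {k} (x : Fin (suc k)) → starE x x ≡ false
starE-irr zero    = _≡_.refl
starE-irr (suc _) = _≡_.refl

Star : ℕ → Graph
Star k = record { n = suc k ; E = starE ; E-sym = starE-sym ; E-irr = starE-irr }

IsStar : Graph → Set
IsStar G = ∃[ k ] Iso G (Star k)

record Path (G : Graph) (ℓ : ℕ) : Set where
  field
    vtx   : Fin (suc ℓ) → Fin (n G)
    inj   : Injective _≡_ _≡_ vtx
    steps : ∀ (i : Fin ℓ) → Adj G (vtx (inject₁ i)) (vtx (suc i))
open Path public

CycSucc : ∀ {L} → Fin L → Fin L → Set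
CycSucc {L} i j = (suc (toℕ i) ≡ toℕ j) ⊎ ((suc (toℕ i) ≡ L) × (toℕ j ≡ 0))

record Cycle (G : Graph) (L : ℕ) : Set where
  field
    len≥3 : 3 ≤ L
    cvtx  : Fin L → Fin (n G)
    cinj  : Injective _≡_ _≡_ cvtx
    csteps : ∀ (i j : Fin L) → CycSucc i j → Adj G (cvtx i) (cvtx j)
open Cycle public

CycleEdge : ∀ {G L} → Cycle G L → Fin (n G) → Fin (n G) → Set
CycleEdge C x y = ∃[ i ] ∃[ j ] (CycSucc i j ×
  ((cvtx C i ≡ x × cvtx C j ≡ y) ⊎ (cvtx C i ≡ y × cvtx C j ≡ x)))

ClosesToCycle : ∀ {G ℓ} → Path G ℓ → Set
ClosesToCycle {G} {ℓ} P = ∃[ L ] Σ (Cycle G L) λ C →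
  (∀ (k : Fin (suc ℓ)) → ∃[ j ] cvtx C j ≡ vtx P k) ×
  (∀ (i : Fin ℓ) → CycleEdge C (vtx P (inject₁ i)) (vtx P (suc i)))

-- In a connected edge-transitive graph G that is not a star every vertex has two distinct
-- neighbours: otherwise edge-transitivity makes all neighbours of one vertex leaves hanging at
-- it, and G is a star.  The heart of the matter is that the ends u, v of an edge never separate
-- G.  Call a nonempty union X of components of G − {u, v} that misses some vertex a fragment.
-- Some x ∈ X has a neighbour y ∈ X (otherwise x, u, v span a triangle of degree-two vertices,
-- which is then all of G); an automorphism carries the fragment onto the edge {x, y}, and
-- either the image or its complement in G − {x, y} is a fragment strictly inside X.  So there
-- are no fragments, and a path a b c d closes up through a path from d back to a avoiding b
-- and c.  Shorter paths close as a triangle or are first prolonged by a fresh neighbour of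
-- their first vertex.
--
-- For ℓ ≥ 4 take the cycle C_N with every edge replaced by two parallel paths of length two.
-- Rotations, a reflection and the exchange of the two parallel paths make it edge-transitive.
-- The two middle vertices of a doubled edge are twins of degree two, so a cycle through both
-- is the 4-cycle they span; hence the zigzag path that starts twin, end, twin, end, … does not
-- close once it has length at least four.

module Submission where

open import Defs
open import Data.Nat using (ℕ; _≤_)
open import Data.Product using (_×_; Σ)
open import Relation.Nullary using (¬_)
open import Relation.Binary.PropositionalEquality using (_≡_)

open import Data.Bool using (Bool; true; false; not)
import Data.Bool as Bool
open import Data.Bool.Properties using (¬-not; not-involutive)
open import Data.Empty using (⊥-elim)
open import Data.Fin using (Fin; zero; suc; toℕ; fromℕ; inject₁; lower₁; opposite)
open import Data.Fin.Induction using (<-weakInduction; <-weakInduction-startingFrom)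
open import Data.Fin.Patterns using (0F; 1F; 2F; 3F; 4F)
open import Data.Fin.Permutation using (transpose; ↔⇒≡)
open import Data.Fin.Properties using (*↔×)
import Data.Fin.Properties as Finₚ
open import Data.Fin.Subset using (Subset; _∈_; _∉_; _⊂_; ∁; _∪_; ⁅_⁆; ∣_∣; Nonempty)
open import Data.Fin.Subset.Properties
  using (_∈?_; p⊆p∪q; ∣p∣≤n; p⊂q⇒∣p∣<∣q∣; x∈p∪q⁺; x∈p∪q⁻; x∈⁅x⁆; x∈⁅y⁆⇒x≡y
        ; x∈∁p⇒x∉p; x∉p⇒x∈∁p)
open import Data.Nat as ℕ using (_<_; _+_; _∸_; z≤n; s≤s)
open import Data.Nat.Induction using (<-wellFounded)
import Data.Nat.Properties as ℕₚ
open import Data.Product using (proj₁; proj₂; _,_; ∃-syntax)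
open import Data.Sum using (_⊎_; inj₁; inj₂; [_,_]′) renaming (map to ⊎-map; swap to ⊎-swap)
open import Data.Vec using (tabulate; lookup)
open import Data.Vec.Properties using (lookup∘tabulate; []=⇒lookup; lookup⇒[]=)
open import Function using (_∘_; id)
open import Function.Bundles using (Inverse; Injection; _↔_; _⇔_; mk↔ₛ′; mk⇔)
open import Function.Construct.Composition using (_↔-∘_)
open import Function.Construct.Identity using (↔-id)
open import Function.Construct.Symmetry using (↔-sym)
open import Function.Properties.Inverse using (↔⇒↣)
open import Induction.WellFounded using (Acc; acc)
open import Relation.Binary.PropositionalEquality
  using (_≢_; refl; sym; trans; cong; cong₂; subst; subst₂; module ≡-Reasoning)
open import Relation.Nullary using (Dec; yes; no; does; ¬?)
open import Relation.Nullary.Decidable using (_×-dec_; _⊎-dec_; dec-true; does-⇔)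
open import Relation.Unary using (Decidable)

open ≡-Reasoning

OneOf : {A : Set} → A → A → A → Set
OneOf t p q = t ≡ p ⊎ t ≡ q

oneOf-swap : {A : Set} {t p q : A} → OneOf t p q → OneOf t q p
oneOf-swap (inj₁ t≡p) = inj₂ t≡p
oneOf-swap (inj₂ t≡q) = inj₁ t≡q

oneOf-same : {A : Set} {t p : A} → OneOf t p p → t ≡ p
oneOf-same (inj₁ t≡p) = t≡p
oneOf-same (inj₂ t≡p) = t≡p

oneOf-cover : {A : Set} {t x y p q : A} →
              OneOf x p q → OneOf y p q → x ≢ y → OneOf t p q → OneOf t x y
oneOf-cover (inj₁ refl) (inj₁ refl) x≢y _      = ⊥-elim (x≢y refl)
oneOf-cover (inj₂ refl) (inj₂ refl) x≢y _      = ⊥-elim (x≢y refl)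
oneOf-cover (inj₁ refl) (inj₂ refl) _   t∈pq   = t∈pq
oneOf-cover (inj₂ refl) (inj₁ refl) _   t∈pq   = oneOf-swap t∈pq

↔-injective : {A B : Set} (f : A ↔ B) {x y : A} → Inverse.to f x ≡ Inverse.to f y → x ≡ y
↔-injective f = Injection.injective (↔⇒↣ f)

does-true : {P : Set} (P? : Dec P) → does P? ≡ true → P
does-true (yes p) _ = p

∈⁅⁆-subst : ∀ {m} {x y : Fin m} (P : Fin m → Set) → P y → x ∈ ⁅ y ⁆ → P x
∈⁅⁆-subst {y = y} P Py x∈y = subst P (sym (x∈⁅y⁆⇒x≡y y x∈y)) Py

-- Cyclic successor on Fin (suc M)

opposite-inject₁ : ∀ {M} (k : Fin M) → opposite (inject₁ k) ≡ suc (opposite k)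
opposite-inject₁ {ℕ.suc M} zero    = refl
opposite-inject₁ {ℕ.suc M} (suc k) = cong inject₁ (opposite-inject₁ k)

opposite-fromℕ : ∀ M → opposite (fromℕ M) ≡ zero
opposite-fromℕ ℕ.zero    = refl
opposite-fromℕ (ℕ.suc M) = cong inject₁ (opposite-fromℕ M)

module _ {M : ℕ} where

  next : Fin (ℕ.suc M) → Fin (ℕ.suc M)
  next i with M ℕ.≟ toℕ i
  ... | yes _   = zero
  ... | no M≢i  = suc (lower₁ i M≢i)

  prev : Fin (ℕ.suc M) → Fin (ℕ.suc M)
  prev zero    = fromℕ M
  prev (suc k) = inject₁ k

  next-inject₁ : ∀ (k : Fin M) → next (inject₁ k) ≡ suc k
  next-inject₁ k with M ℕ.≟ toℕ (inject₁ k)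
  ... | yes M≡k = ⊥-elim (Finₚ.toℕ-inject₁-≢ k M≡k)
  ... | no M≢k  = cong suc (Finₚ.lower₁-inject₁′ k M≢k)

  next-fromℕ : next (fromℕ M) ≡ zero
  next-fromℕ with M ℕ.≟ toℕ (fromℕ M)
  ... | yes _   = refl
  ... | no M≢M  = ⊥-elim (M≢M (sym (Finₚ.toℕ-fromℕ M)))

  next-prev : ∀ i → next (prev i) ≡ i
  next-prev zero    = next-fromℕ
  next-prev (suc k) = next-inject₁ k

  prev-next : ∀ i → prev (next i) ≡ i
  prev-next i with M ℕ.≟ toℕ i
  ... | yes M≡i = Finₚ.toℕ-injective (trans (Finₚ.toℕ-fromℕ M) M≡i)
  ... | no M≢i  = Finₚ.inject₁-lower₁ i M≢i

  toℕ-next : ∀ i → M ≢ toℕ i → toℕ (next i) ≡ ℕ.suc (toℕ i)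
  toℕ-next i M≢i with M ℕ.≟ toℕ i
  ... | yes M≡i  = ⊥-elim (M≢i M≡i)
  ... | no M≢i′  = cong ℕ.suc (Finₚ.toℕ-lower₁ i M≢i′)

  next-last : ∀ i → M ≡ toℕ i → next i ≡ zero
  next-last i M≡i with M ℕ.≟ toℕ i
  ... | yes _   = refl
  ... | no M≢i  = ⊥-elim (M≢i M≡i)

  next-elim : (R : Fin (ℕ.suc M) → Fin (ℕ.suc M) → Set) →
              (∀ k → R (inject₁ k) (suc k)) → R (fromℕ M) zero → ∀ i → R i (next i)
  next-elim R inner last i = subst (λ h → R h (next i)) (prev-next i) (R-prev (next i))
    where
    R-prev : ∀ j → R (prev j) j
    R-prev zero    = last
    R-prev (suc k) = inner k

  cycSucc-inject₁ : ∀ (k : Fin M) → CycSucc (inject₁ k) (suc k)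
  cycSucc-inject₁ k = inj₁ (cong ℕ.suc (Finₚ.toℕ-inject₁ k))

  cycSucc-fromℕ : CycSucc (fromℕ M) zero
  cycSucc-fromℕ = inj₂ (cong ℕ.suc (Finₚ.toℕ-fromℕ M) , refl)

  cycSucc-next : ∀ i → CycSucc i (next i)
  cycSucc-next = next-elim CycSucc cycSucc-inject₁ cycSucc-fromℕ

  cycSucc⇒prev : ∀ {i j} → CycSucc i j → i ≡ prev j
  cycSucc⇒prev {i} {zero}  (inj₂ (i+1≡L , _)) =
    Finₚ.toℕ-injective (trans (ℕₚ.suc-injective i+1≡L) (sym (Finₚ.toℕ-fromℕ M)))
  cycSucc⇒prev {i} {suc k} (inj₁ i+1≡j) =
    Finₚ.toℕ-injective (trans (ℕₚ.suc-injective i+1≡j) (sym (Finₚ.toℕ-inject₁ k)))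

  cycSucc⇒next : ∀ {i j} → CycSucc i j → next i ≡ j
  cycSucc⇒next {j = j} s = trans (cong next (cycSucc⇒prev s)) (next-prev j)

  next-orbit : (P : Fin (ℕ.suc M) → Set) → (∀ {i} → P i → P (next i)) → ∀ {i} → P i → ∀ j → P j
  next-orbit P P-next {i} Pi = <-weakInduction P P-zero climb
    where
    climb : ∀ k → P (inject₁ k) → P (suc k)
    climb k = subst P (next-inject₁ k) ∘ P-next
    P-zero : P zero
    P-zero = subst P next-fromℕ (P-next (<-weakInduction-startingFrom P Pi climb (Finₚ.≤fromℕ i)))

  next²≢id : 2 ≤ M → ∀ i → next (next i) ≢ i
  next²≢id 2≤M i = cases (M ℕ.≟ toℕ i) (M ℕ.≟ toℕ (next i))
    where
    M≢0 : M ≢ 0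
    M≢0 M≡0 = ℕₚ.<⇒≢ (ℕₚ.<-trans (s≤s z≤n) 2≤M) (sym M≡0)
    M≢1 : M ≢ 1
    M≢1 M≡1 = ℕₚ.<⇒≢ 2≤M (sym M≡1)
    cases : Dec (M ≡ toℕ i) → Dec (M ≡ toℕ (next i)) → next (next i) ≢ i
    cases (yes M≡i) _ e = M≢1 (begin
      M                       ≡⟨ M≡i ⟩
      toℕ i                   ≡⟨ cong toℕ e ⟨
      toℕ (next (next i))     ≡⟨ cong (toℕ ∘ next) (next-last i M≡i) ⟩
      toℕ (next (zero {M}))   ≡⟨ toℕ-next zero M≢0 ⟩
      1                       ∎)
    cases (no M≢i) (yes M≡i′) e = M≢1 (begin
      M                       ≡⟨ M≡i′ ⟩
      toℕ (next i)            ≡⟨ toℕ-next i M≢i ⟩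
      ℕ.suc (toℕ i)           ≡⟨ cong (ℕ.suc ∘ toℕ) (trans (sym e) (next-last (next i) M≡i′)) ⟩
      1                       ∎)
    cases (no M≢i) (no M≢i′) e = ℕₚ.m≢1+n+m (toℕ i) (begin
      toℕ i                   ≡⟨ cong toℕ e ⟨
      toℕ (next (next i))     ≡⟨ toℕ-next (next i) M≢i′ ⟩
      ℕ.suc (toℕ (next i))    ≡⟨ cong ℕ.suc (toℕ-next i M≢i) ⟩
      ℕ.suc (ℕ.suc (toℕ i))   ∎)

  prev≢next : 2 ≤ M → ∀ i → prev i ≢ next i
  prev≢next 2≤M i e = next²≢id 2≤M i (trans (cong next (sym e)) (next-prev i))

  opposite-next : ∀ i → opposite (next i) ≡ prev (opposite i)
  opposite-next = next-elim (λ i j → opposite j ≡ prev (opposite i))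
                            (λ k → sym (cong prev (opposite-inject₁ k))) (sym (cong prev (opposite-fromℕ M)))

-- Graphs, walks and automorphisms

module GraphBasics (G : Graph) where

  V : Set
  V = Fin (n G)

  private variable
    a p q r t u v x y z : V

  infix 4 _~_ _~?_
  _~_ : V → V → Set
  _~_ = Adj G

  _~?_ : ∀ x y → Dec (x ~ y)
  x ~? y = E G x y Bool.≟ true

  ~-sym : x ~ y → y ~ x
  ~-sym {x} {y} x~y = trans (E-sym G y x) x~y

  ~-irrefl : ¬ x ~ x
  ~-irrefl {x} x~x with trans (sym x~x) (E-irr G x)
  ... | ()

  NeighboursAmong : V → V → V → Set
  NeighboursAmong a p q = ∀ {t} → a ~ t → OneOf t p q

  neighboursAmong-pin : NeighboursAmong a p q → a ~ x → a ~ y → x ≢ y → NeighboursAmong a x y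
  neighboursAmong-pin N a~x a~y x≢y a~t = oneOf-cover (N a~x) (N a~y) x≢y (N a~t)

  Hub : V → Set
  Hub c = ∀ {w} → c ~ w → NeighboursAmong w c c

  Deg≤1 Deg≤2 : V → Set
  Deg≤1 a = ∃[ r ] NeighboursAmong a r r
  Deg≤2 a = ∃[ p ] ∃[ q ] NeighboursAmong a p q

  Closed : (V → Set) → Set
  Closed T = ∀ {p q} → T p → p ~ q → T q

  walk-closed : ∀ {T} → Closed T → Walk G x y → T x → T y
  walk-closed closed here          Tx = Tx
  walk-closed closed (step x~y w)  Tx = walk-closed closed w (closed Tx x~y)

  connected-closed : Connected G → ∀ {T} → Closed T → T x → ∀ y → T y
  connected-closed conn closed Tx y = walk-closed closed (proj₂ conn _ y) Tx

  infixl 5 _▷_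
  infixr 5 _++ʷ_

  _▷_ : Walk G x y → y ~ z → Walk G x z
  here        ▷ y~z = step y~z here
  step x~w w  ▷ y~z = step x~w (w ▷ y~z)

  _++ʷ_ : Walk G x y → Walk G y z → Walk G x z
  here        ++ʷ w′ = w′
  step x~u w  ++ʷ w′ = step x~u (w ++ʷ w′)

  reverseʷ : Walk G x y → Walk G y x
  reverseʷ here         = here
  reverseʷ (step x~u w) = reverseʷ w ▷ ~-sym x~u

  hub-adjacent : Connected G → Hub a → x ≢ a → a ~ x
  hub-adjacent {a} {x} conn hub x≢a with connected-closed conn closed (inj₁ refl) x
    where
    closed : Closed (λ s → s ≡ a ⊎ a ~ s)
    closed (inj₁ refl) a~q = inj₂ a~q
    closed (inj₂ a~p)  p~q = inj₁ (oneOf-same (hub a~p p~q))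
  ... | inj₁ x≡a = ⊥-elim (x≢a x≡a)
  ... | inj₂ a~x = a~x

  connected-from-root : (r : V) → (∀ x → Walk G r x) → Connected G
  connected-from-root r walk-from-r =
    ℕₚ.≤-<-trans z≤n (Finₚ.toℕ<n r) , λ x y → reverseʷ (walk-from-r x) ++ʷ walk-from-r y

module AutAction {G : Graph} (φ : Aut G) where
  open GraphBasics G
  open Inverse (proj₁ φ) public using (to; from; strictlyInverseˡ; strictlyInverseʳ)

  private variable
    x y : V

  from-~ : x ~ y → from x ~ from y
  from-~ {x} {y} x~y =
    trans (proj₂ φ (from x) (from y)) (trans (cong₂ (E G) (strictlyInverseˡ x) (strictlyInverseˡ y)) x~y)

  to-injective : to x ≡ to y → x ≡ y
  to-injective = ↔-injective (proj₁ φ)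

  from-to : to x ≡ y → from y ≡ x
  from-to {x} to-x≡y = trans (cong from (sym to-x≡y)) (strictlyInverseʳ x)

  neighboursAmong-to : ∀ {a p q} → NeighboursAmong a p q → NeighboursAmong (to a) (to p) (to q)
  neighboursAmong-to {a} N {t} a~t with N (subst (_~ from t) (strictlyInverseʳ a) (from-~ a~t))
  ... | inj₁ e = inj₁ (trans (sym (strictlyInverseˡ t)) (cong to e))
  ... | inj₂ e = inj₂ (trans (sym (strictlyInverseˡ t)) (cong to e))

module Automorphisms (G : Graph) where
  open GraphBasics G

  infixr 9 _∘ᵃ_
  _∘ᵃ_ : Aut G → Aut G → Aut G
  (φ , φ-adj) ∘ᵃ (ψ , ψ-adj) = φ ↔-∘ ψ , λ x y → trans (ψ-adj x y) (φ-adj _ _)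

  inverseᵃ : Aut G → Aut G
  inverseᵃ φ = ↔-sym (proj₁ φ) , λ x y →
    sym (trans (proj₂ φ (from x) (from y)) (cong₂ (E G) (strictlyInverseˡ x) (strictlyInverseˡ y)))
    where open AutAction {G} φ

  apply : Aut G → V → V
  apply φ = AutAction.to {G} φ

  Carries : Aut G → V → V → V → V → Set
  Carries φ x y u v = (apply φ x ≡ u × apply φ y ≡ v) ⊎ (apply φ x ≡ v × apply φ y ≡ u)

  carries-inverse : ∀ φ {x y u v} → Carries φ x y u v → Carries (inverseᵃ φ) u v x y
  carries-inverse φ (inj₁ (x↦u , y↦v)) = inj₁ (from-to x↦u , from-to y↦v) where open AutAction {G} φ
  carries-inverse φ (inj₂ (x↦v , y↦u)) = inj₂ (from-to y↦u , from-to x↦v) where open AutAction {G} φ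

  carries-∘ : ∀ ψ φ {x y u v s t} → Carries φ x y u v → Carries ψ u v s t → Carries (ψ ∘ᵃ φ) x y s t
  carries-∘ ψ φ (inj₁ (x↦u , y↦v)) (inj₁ (u↦s , v↦t)) =
    inj₁ (trans (cong (apply ψ) x↦u) u↦s , trans (cong (apply ψ) y↦v) v↦t)
  carries-∘ ψ φ (inj₁ (x↦u , y↦v)) (inj₂ (u↦t , v↦s)) =
    inj₂ (trans (cong (apply ψ) x↦u) u↦t , trans (cong (apply ψ) y↦v) v↦s)
  carries-∘ ψ φ (inj₂ (x↦v , y↦u)) (inj₁ (u↦s , v↦t)) =
    inj₂ (trans (cong (apply ψ) x↦v) v↦t , trans (cong (apply ψ) y↦u) u↦s)
  carries-∘ ψ φ (inj₂ (x↦v , y↦u)) (inj₂ (u↦t , v↦s)) =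
    inj₁ (trans (cong (apply ψ) x↦v) v↦s , trans (cong (apply ψ) y↦u) u↦t)

  edge-transitive-via : ∀ u v → (∀ {x y} → x ~ y → Σ (Aut G) λ φ → Carries φ x y u v) → EdgeTransitive G
  edge-transitive-via u v carry x y x′ y′ x~y x′~y′ with carry x~y | carry x′~y′
  ... | φ , xy↦uv | ψ , x′y′↦uv = inverseᵃ ψ ∘ᵃ φ , carries-∘ (inverseᵃ ψ) φ xy↦uv (carries-inverse ψ x′y′↦uv)

  AutInvariant : (V → Set) → Set
  AutInvariant Q = ∀ (φ : Aut G) {x} → Q x → Q (apply φ x)

  deg≤1-invariant : AutInvariant Deg≤1
  deg≤1-invariant φ (r , N) = _ , AutAction.neighboursAmong-to {G} φ N

  deg≤2-invariant : AutInvariant Deg≤2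
  deg≤2-invariant φ (p , q , N) = _ , _ , AutAction.neighboursAmong-to {G} φ N

  module _ (et : EdgeTransitive G) {Q : V → Set} (invariant : AutInvariant Q) where

    invariant-at-some-end : ∀ {a b c d} → Q a → a ~ b → c ~ d → Q c ⊎ Q d
    invariant-at-some-end {a} {b} {c} {d} Qa a~b c~d with et a b c d a~b c~d
    ... | φ , inj₁ (φa≡c , _) = inj₁ (subst Q φa≡c (invariant φ Qa))
    ... | φ , inj₂ (φa≡d , _) = inj₂ (subst Q φa≡d (invariant φ Qa))

    invariant-at-both-ends : ∀ {a b c d} → Q a → Q b → a ~ b → c ~ d → Q c × Q d
    invariant-at-both-ends {a} {b} {c} {d} Qa Qb a~b c~d with et a b c d a~b c~d
    ... | φ , inj₁ (φa≡c , φb≡d) = subst Q φa≡c (invariant φ Qa) , subst Q φb≡d (invariant φ Qb)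
    ... | φ , inj₂ (φa≡d , φb≡c) = subst Q φb≡c (invariant φ Qb) , subst Q φa≡d (invariant φ Qa)

module Paths (G : Graph) where
  open GraphBasics G

  private variable
    ℓ : ℕ
    w x y z : V
    A B : V → Set

  cycle-edge : ∀ {L} (C : Cycle G L) {i j} → CycSucc i j → CycleEdge C (cvtx C i) (cvtx C j)
  cycle-edge C {i} {j} i→j = i , j , i→j , inj₁ (refl , refl)

  path-distinct : (P : Path G ℓ) {i j : Fin (ℕ.suc ℓ)} → i ≢ j → vtx P i ≢ vtx P j
  path-distinct P i≢j = i≢j ∘ inj P

  prepend : (w : V) (P : Path G ℓ) → w ~ vtx P 0F → (∀ k → vtx P k ≢ w) → Path G (ℕ.suc ℓ)
  prepend w P w~P fresh = record { vtx = vertex ; inj = injective ; steps = adjacent }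
    where
    vertex : Fin _ → V
    vertex zero    = w
    vertex (suc k) = vtx P k
    injective : ∀ {i j} → vertex i ≡ vertex j → i ≡ j
    injective {zero}  {zero}  _ = refl
    injective {zero}  {suc j} e = ⊥-elim (fresh j (sym e))
    injective {suc i} {zero}  e = ⊥-elim (fresh i e)
    injective {suc i} {suc j} e = cong suc (inj P e)
    adjacent : ∀ i → vertex (inject₁ i) ~ vertex (suc i)
    adjacent zero    = w~P
    adjacent (suc i) = steps P i

  prepend-closes : (P : Path G ℓ) (w~P : w ~ vtx P 0F) (fresh : ∀ k → vtx P k ≢ w) →
                   ClosesToCycle (prepend w P w~P fresh) → ClosesToCycle P
  prepend-closes P w~P fresh (L , C , on-C , edges-on-C) = L , C , on-C ∘ suc , edges-on-C ∘ suc

  close-path : (P : Path G ℓ) → 2 ≤ ℓ → vtx P (fromℕ ℓ) ~ vtx P 0F → Cycle G (ℕ.suc ℓ)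
  close-path P 2≤ℓ last~first = record
    { len≥3  = s≤s 2≤ℓ
    ; cvtx   = vtx P
    ; cinj   = inj P
    ; csteps = λ i j i→j → subst (λ h → vtx P i ~ vtx P h) (cycSucc⇒next i→j)
                                 (next-elim (λ a b → vtx P a ~ vtx P b) (steps P) last~first i)
    }

  path-closes : (P : Path G ℓ) → 2 ≤ ℓ → vtx P (fromℕ ℓ) ~ vtx P 0F → ClosesToCycle P
  path-closes {ℓ} P 2≤ℓ last~first = _ , C , (λ k → k , refl) , λ i → cycle-edge C (cycSucc-inject₁ i)
    where
    C : Cycle G (ℕ.suc ℓ)
    C = close-path P 2≤ℓ last~first

  record Route (A : V → Set) (x y : V) : Set where
    field
      length : ℕ
      path   : Path G length
      starts : vtx path 0F ≡ x
      ends   : vtx path (fromℕ length) ≡ y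
      within : ∀ k → A (vtx path k)

  route-here : A x → Route A x x
  route-here {x = x} Ax = record
    { length = 0
    ; path   = record { vtx = λ _ → x ; inj = λ { {0F} {0F} _ → refl } ; steps = λ () }
    ; starts = refl
    ; ends   = refl
    ; within = λ { 0F → Ax }
    }

  route-cons : x ~ y → ¬ A x → Route A y z → Route (λ t → t ≡ x ⊎ A t) x z
  route-cons {x} {A = A} x~y ¬Ax r = record
    { length = ℕ.suc length
    ; path   = prepend x path (subst (x ~_) (sym starts) x~y) (λ k e → ¬Ax (subst A e (within k)))
    ; starts = refl
    ; ends   = ends
    ; within = λ { zero → inj₁ refl ; (suc k) → inj₂ (within k) }
    }
    where open Route r

  route-mono : (∀ {t} → A t → B t) → Route A x y → Route B x y
  route-mono A⇒B r = record { Route r ; within = A⇒B ∘ Route.within r }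

-- Paths of length at most three close

starE-hub : ∀ {k} (b : Fin (ℕ.suc k)) → b ≢ 0F → starE 0F b ≡ true
starE-hub 0F      b≢0 = ⊥-elim (b≢0 refl)
starE-hub (suc _) _   = refl

starE-spokes : ∀ {k} (a b : Fin (ℕ.suc k)) → a ≢ 0F → b ≢ 0F → starE a b ≡ false
starE-spokes 0F      _       a≢0 _   = ⊥-elim (a≢0 refl)
starE-spokes (suc _) 0F      _   b≢0 = ⊥-elim (b≢0 refl)
starE-spokes (suc _) (suc _) _   _   = refl

star-of-hub : (G : Graph) → Connected G → (c : Fin (n G)) → GraphBasics.Hub G c → IsStar G
star-of-hub G@(record { n = ℕ.suc k }) conn c hub = k , τ , adjacency
  where
  open GraphBasics G

  spoke : ∀ {w} → w ≢ c → c ~ w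
  spoke = hub-adjacent conn hub

  leaf : ∀ {x y} → x ≢ c → x ~ y → y ≡ c
  leaf x≢c x~y = oneOf-same (hub (spoke x≢c) x~y)

  τ : Fin (ℕ.suc k) ↔ Fin (ℕ.suc k)
  τ = transpose c 0F

  open Inverse τ using (to; from; strictlyInverseʳ)

  τ-c : to c ≡ 0F
  τ-c rewrite dec-true (c Finₚ.≟ c) refl = refl

  τ≢0 : ∀ {x} → x ≢ c → to x ≢ 0F
  τ≢0 {x} x≢c τx≡0 = x≢c (trans (sym (strictlyInverseʳ x)) (cong from τx≡0))

  adjacency-cases : ∀ x y → Dec (x ≡ c) → Dec (y ≡ c) → E G x y ≡ starE (to x) (to y)
  adjacency-cases x y (yes refl) (yes refl) = trans (E-irr G c) (sym (cong₂ starE τ-c τ-c))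
  adjacency-cases x y (yes refl) (no y≢c)   =
    trans (spoke y≢c) (sym (trans (cong (λ h → starE h (to y)) τ-c) (starE-hub _ (τ≢0 y≢c))))
  adjacency-cases x y (no x≢c)   (yes refl) =
    trans (trans (E-sym G x c) (spoke x≢c))
          (sym (trans (cong (starE (to x)) τ-c) (trans (starE-sym _ 0F) (starE-hub _ (τ≢0 x≢c)))))
  adjacency-cases x y (no x≢c)   (no y≢c)   =
    trans (¬-not (λ x~y → y≢c (leaf x≢c x~y))) (sym (starE-spokes _ _ (τ≢0 x≢c) (τ≢0 y≢c)))

  adjacency : ∀ x y → E G x y ≡ starE (to x) (to y)
  adjacency x y = adjacency-cases x y (x Finₚ.≟ c) (y Finₚ.≟ c)

module Fragments (G : Graph) where
  open GraphBasics G

  private variable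
    t u v w x y : V
    X W : Subset (n G)

  beyond : Subset (n G) → V → V → Subset (n G)
  beyond X u v = ∁ (X ∪ ⁅ u ⁆ ∪ ⁅ v ⁆)

  ∈-beyond⁺ : t ∉ X → t ≢ u → t ≢ v → t ∈ beyond X u v
  ∈-beyond⁺ {t} {X} {u} {v} t∉X t≢u t≢v = x∉p⇒x∈∁p inside
    where
    inside : t ∉ X ∪ ⁅ u ⁆ ∪ ⁅ v ⁆
    inside m with x∈p∪q⁻ X _ m
    ... | inj₁ t∈X = t∉X t∈X
    ... | inj₂ m′ with x∈p∪q⁻ ⁅ u ⁆ ⁅ v ⁆ m′
    ...   | inj₁ t∈u = t≢u (x∈⁅y⁆⇒x≡y u t∈u)
    ...   | inj₂ t∈v = t≢v (x∈⁅y⁆⇒x≡y v t∈v)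

  ∈-beyond⁻ : t ∈ beyond X u v → t ∉ X × t ≢ u × t ≢ v
  ∈-beyond⁻ {t} {X} {u} {v} t∈B =
      (λ t∈X → outside (x∈p∪q⁺ (inj₁ t∈X)))
    , (λ { refl → outside (x∈p∪q⁺ (inj₂ (x∈p∪q⁺ (inj₁ (x∈⁅x⁆ t))))) })
    , (λ { refl → outside (x∈p∪q⁺ (inj₂ (x∈p∪q⁺ (inj₂ (x∈⁅x⁆ t))))) })
    where
    outside : t ∉ X ∪ ⁅ u ⁆ ∪ ⁅ v ⁆
    outside = x∈∁p⇒x∉p t∈B

  record Fragment (u v : V) (X : Subset (n G)) : Set where
    field
      inhabited : Nonempty X
      proper    : Nonempty (beyond X u v)
      avoids    : x ∈ X → x ≢ u × x ≢ v
      closed    : x ∈ X → x ~ y → y ∉ X → OneOf y u v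

  fragment-swap : Fragment u v X → Fragment v u X
  fragment-swap F = record
    { inhabited = inhabited
    ; proper    = let w , w∈B = proper ; w∉X , w≢u , w≢v = ∈-beyond⁻ w∈B in w , ∈-beyond⁺ w∉X w≢v w≢u
    ; avoids    = λ x∈X → let x≢u , x≢v = avoids x∈X in x≢v , x≢u
    ; closed    = λ x∈X x~y y∉X → oneOf-swap (closed x∈X x~y y∉X)
    }
    where open Fragment F

  fragment-complement : Fragment u v X → Fragment u v (beyond X u v)
  fragment-complement {u} {v} {X} F = record
    { inhabited = proper
    ; proper    = let x , x∈X = inhabited ; x≢u , x≢v = avoids x∈X in
                  x , ∈-beyond⁺ (λ x∈B → proj₁ (∈-beyond⁻ x∈B) x∈X) x≢u x≢v
    ; avoids    = λ x∈B → proj₂ (∈-beyond⁻ x∈B)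
    ; closed    = closed′
    }
    where
    open Fragment F
    closed′ : x ∈ beyond X u v → x ~ y → y ∉ beyond X u v → OneOf y u v
    closed′ {x} {y} x∈B x~y y∉B with ∈-beyond⁻ x∈B | y ∈? X
    ... | x∉X , x≢u , x≢v | yes y∈X with closed y∈X (~-sym x~y) x∉X
    ...   | inj₁ x≡u = ⊥-elim (x≢u x≡u)
    ...   | inj₂ x≡v = ⊥-elim (x≢v x≡v)
    closed′ {x} {y} x∈B x~y y∉B | _ | no y∉X with y Finₚ.≟ u | y Finₚ.≟ v
    ... | yes y≡u | _       = inj₁ y≡u
    ... | no _    | yes y≡v = inj₂ y≡v
    ... | no y≢u  | no y≢v  = ⊥-elim (y∉B (∈-beyond⁺ y∉X y≢u y≢v))

  module _ (φ : Aut G) where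
    open AutAction {G} φ

    image : Subset (n G) → Subset (n G)
    image X = tabulate (λ t → lookup X (from t))

    ∈-image⁺ : from t ∈ X → t ∈ image X
    ∈-image⁺ {t} {X} m = lookup⇒[]= t (image X) (trans (lookup∘tabulate _ t) ([]=⇒lookup m))

    ∈-image⁻ : t ∈ image X → from t ∈ X
    ∈-image⁻ {t} {X} m = lookup⇒[]= (from t) X (trans (sym (lookup∘tabulate _ t)) ([]=⇒lookup m))

    to-∈-image : x ∈ X → to x ∈ image X
    to-∈-image {x} {X} x∈X = ∈-image⁺ (subst (_∈ X) (sym (strictlyInverseʳ x)) x∈X)

    fragment-image : Fragment u v X → Fragment (to u) (to v) (image X)
    fragment-image {u} {v} {X} F = record
      { inhabited = let x , x∈X = inhabited in to x , to-∈-image x∈X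
      ; proper    = let w , w∈B = proper ; w∉X , w≢u , w≢v = ∈-beyond⁻ w∈B in
                    to w , ∈-beyond⁺ (λ m → w∉X (subst (_∈ X) (strictlyInverseʳ w) (∈-image⁻ m)))
                                     (w≢u ∘ to-injective) (w≢v ∘ to-injective)
      ; avoids    = λ t∈I → let t≢u , t≢v = avoids (∈-image⁻ t∈I) in
                    (λ { refl → t≢u (strictlyInverseʳ u) }) , (λ { refl → t≢v (strictlyInverseʳ v) })
      ; closed    = closed′
      }
      where
      open Fragment F
      back : OneOf (from t) u v → OneOf t (to u) (to v)
      back {t} (inj₁ e) = inj₁ (trans (sym (strictlyInverseˡ t)) (cong to e))
      back {t} (inj₂ e) = inj₂ (trans (sym (strictlyInverseˡ t)) (cong to e))
      closed′ : x ∈ image X → x ~ y → y ∉ image X → OneOf y (to u) (to v)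
      closed′ x∈I x~y y∉I = back (closed (∈-image⁻ x∈I) (from-~ x~y) (y∉I ∘ ∈-image⁺))

module Exploration (G : Graph) {A : Fin (n G) → Set} (A? : Decidable A) where
  open GraphBasics G
  open Paths G

  record Explored (a : V) (R : Subset (n G)) : Set where
    field
      root    : a ∈ R
      allowed : ∀ {x} → x ∈ R → A x
      routes  : ∀ {x} → x ∈ R → Route (_∈ R) x a

  explored-extend : ∀ {a R p q} → Explored a R → p ∈ R → p ~ q → q ∉ R → A q → Explored a (R ∪ ⁅ q ⁆)
  explored-extend {a} {R} {p} {q} E p∈R p~q q∉R Aq = record
    { root    = x∈p∪q⁺ (inj₁ root)
    ; allowed = [ allowed , ∈⁅⁆-subst A Aq ]′ ∘ x∈p∪q⁻ R ⁅ q ⁆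
    ; routes  = [ route-mono (x∈p∪q⁺ ∘ inj₁) ∘ routes , ∈⁅⁆-subst (λ x → Route _ x a) route-q ]′
                ∘ x∈p∪q⁻ R ⁅ q ⁆
    }
    where
    open Explored E
    route-q : Route (_∈ R ∪ ⁅ q ⁆) q a
    route-q = route-mono [ (λ { refl → x∈p∪q⁺ (inj₂ (x∈⁅x⁆ q)) }) , x∈p∪q⁺ ∘ inj₁ ]′
                         (route-cons (~-sym p~q) q∉R (routes p∈R))

  ClosedWithin : Subset (n G) → Set
  ClosedWithin R = ∀ {p q} → p ∈ R → p ~ q → A q → q ∈ R

  explore : ∀ {a} → A a → ∃[ R ] Explored a R × ClosedWithin R
  explore {a} Aa = grow ⁅ a ⁆ (<-wellFounded _) start
    where
    start : Explored a ⁅ a ⁆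
    start = record
      { root    = x∈⁅x⁆ a
      ; allowed = ∈⁅⁆-subst A Aa
      ; routes  = ∈⁅⁆-subst (λ x → Route _ x a) (route-here (x∈⁅x⁆ a))
      }
    grow : ∀ R → Acc _<_ (n G ∸ ∣ R ∣) → Explored a R → ∃[ R ] Explored a R × ClosedWithin R
    grow R (acc smaller) E
      with Finₚ.any? (λ p → Finₚ.any? (λ q → (p ∈? R) ×-dec ((p ~? q) ×-dec (¬? (q ∈? R) ×-dec A? q))))
    ... | yes (p , q , p∈R , p~q , q∉R , Aq) =
      grow (R ∪ ⁅ q ⁆) (smaller (ℕₚ.∸-monoʳ-< (p⊂q⇒∣p∣<∣q∣ R⊂R′) (∣p∣≤n (R ∪ ⁅ q ⁆))))
           (explored-extend E p∈R p~q q∉R Aq)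
      where
      R⊂R′ : R ⊂ R ∪ ⁅ q ⁆
      R⊂R′ = p⊆p∪q ⁅ q ⁆ , q , x∈p∪q⁺ (inj₂ (x∈⁅x⁆ q)) , q∉R
    ... | no none = R , E , closed
      where
      closed : ClosedWithin R
      closed {p} {q} p∈R p~q Aq with q ∈? R
      ... | yes q∈R = q∈R
      ... | no q∉R  = ⊥-elim (none (p , q , p∈R , p~q , q∉R , Aq))

module MinimumDegree
  (G : Graph) (conn : Connected G) (et : EdgeTransitive G) (not-star : ¬ IsStar G) where
  open GraphBasics G
  open Automorphisms G

  private variable
    w : V

  another-neighbour : ∀ v u → ∃[ w ] v ~ w × w ≢ u
  another-neighbour v u with Finₚ.any? (λ w → (v ~? w) ×-dec ¬? (w Finₚ.≟ u))
  ... | yes found = found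
  ... | no none = ⊥-elim (not-star (star-of-hub G conn _ (proj₂ hub)))
    where
    only-u : NeighboursAmong v u u
    only-u {t} v~t with t Finₚ.≟ u
    ... | yes t≡u = inj₁ t≡u
    ... | no t≢u  = ⊥-elim (none (t , v~t , t≢u))

    hub : ∃[ c ] Hub c
    hub with v ~? u
    ... | no v≁u  = v , λ v~w → ⊥-elim (v≁u (subst (v ~_) (oneOf-same (only-u v~w)) v~w))
    ... | yes v~u = u , leaf
      where
      leaf : u ~ w → NeighboursAmong w u u
      leaf {w} u~w with invariant-at-some-end et deg≤1-invariant (u , only-u) v~u u~w
      ... | inj₁ (r , N) = subst (λ s → NeighboursAmong s u u)
                                 (trans (oneOf-same (N (~-sym v~u))) (sym (oneOf-same (N u~w)))) only-u
      ... | inj₂ (r , N) = subst (λ s → NeighboursAmong w s s) (sym (oneOf-same (N (~-sym u~w)))) N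

module EdgeEndsDoNotSeparate
  (G : Graph) (conn : Connected G) (et : EdgeTransitive G) (not-star : ¬ IsStar G) where
  open GraphBasics G
  open Automorphisms G
  open Fragments G
  open MinimumDegree G conn et not-star
  open Paths G

  private variable
    t u v w x y : V
    X W : Subset (n G)

  fragment-move : u ~ v → x ~ y → Fragment u v X → ∃[ W ] Fragment x y W
  fragment-move {u} {v} {x} {y} u~v x~y F with et u v x y u~v x~y
  ... | φ , inj₁ (φu≡x , φv≡y) = _ , subst₂ (λ a b → Fragment a b _) φu≡x φv≡y (fragment-image φ F)
  ... | φ , inj₂ (φu≡y , φv≡x) =
    _ , fragment-swap (subst₂ (λ a b → Fragment a b _) φu≡y φv≡x (fragment-image φ F))

  triangle-is-whole-graph : NeighboursAmong x u v → NeighboursAmong u x v → NeighboursAmong v x u →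
                        ∀ w → w ≡ x ⊎ OneOf w u v
  triangle-is-whole-graph {x} {u} {v} Nx Nu Nv = connected-closed conn closed (inj₁ refl)
    where
    closed : Closed (λ s → s ≡ x ⊎ OneOf s u v)
    closed (inj₁ refl)        s~t = inj₂ (Nx s~t)
    closed (inj₂ (inj₁ refl)) s~t with Nu s~t
    ... | inj₁ t≡x = inj₁ t≡x
    ... | inj₂ t≡v = inj₂ (inj₂ t≡v)
    closed (inj₂ (inj₂ refl)) s~t with Nv s~t
    ... | inj₁ t≡x = inj₁ t≡x
    ... | inj₂ t≡u = inj₂ (inj₁ t≡u)

  fragment-¬NeighboursAmong-separator : u ~ v → Fragment u v X → x ∈ X → ¬ NeighboursAmong x u v
  fragment-¬NeighboursAmong-separator {u} {v} {X} {x} u~v F x∈X Nx with proper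
    where open Fragment F
  ... | w , w∈B with ∈-beyond⁻ w∈B | triangle-is-whole-graph Nx Nu Nv w
    where
    open Fragment F
    x≢u : x ≢ u
    x≢u = proj₁ (avoids x∈X)
    x≢v : x ≢ v
    x≢v = proj₂ (avoids x∈X)
    x~v : x ~ v
    x~v with another-neighbour x u
    ... | a , x~a , a≢u with Nx x~a
    ...   | inj₁ a≡u  = ⊥-elim (a≢u a≡u)
    ...   | inj₂ refl = x~a
    x~u : x ~ u
    x~u with another-neighbour x v
    ... | a , x~a , a≢v with Nx x~a
    ...   | inj₁ refl = x~a
    ...   | inj₂ a≡v  = ⊥-elim (a≢v a≡v)
    ends : Deg≤2 u × Deg≤2 v
    ends with invariant-at-some-end et deg≤2-invariant (u , v , Nx) x~u u~v
    ... | inj₁ Du = invariant-at-both-ends et deg≤2-invariant (_ , _ , Nx) Du x~u u~v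
    ... | inj₂ Dv = invariant-at-both-ends et deg≤2-invariant (_ , _ , Nx) Dv x~v u~v
    Nu : NeighboursAmong u x v
    Nu = neighboursAmong-pin (proj₂ (proj₂ (proj₁ ends))) (~-sym x~u) u~v x≢v
    Nv : NeighboursAmong v x u
    Nv = neighboursAmong-pin (proj₂ (proj₂ (proj₂ ends))) (~-sym x~v) (~-sym u~v) x≢u
  ... | w∉X , _ , _ | inj₁ refl = w∉X x∈X
  ... | _ , w≢u , _ | inj₂ (inj₁ w≡u) = w≢u w≡u
  ... | _ , _ , w≢v | inj₂ (inj₂ w≡v) = w≢v w≡v

  fragment-has-inner-edge : u ~ v → Fragment u v X → ∃[ x ] ∃[ y ] x ∈ X × y ∈ X × x ~ y
  fragment-has-inner-edge {u} {v} {X} u~v F with Fragment.inhabited F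
  ... | x , x∈X with Finₚ.any? (λ y → (y ∈? X) ×-dec (x ~? y))
  ...   | yes (y , y∈X , x~y) = x , y , x∈X , y∈X , x~y
  ...   | no none = ⊥-elim (fragment-¬NeighboursAmong-separator u~v F x∈X Nx)
    where
    Nx : NeighboursAmong x u v
    Nx {t} x~t with t ∈? X
    ... | yes t∈X = ⊥-elim (none (t , t∈X , x~t))
    ... | no t∉X  = Fragment.closed F x∈X x~t t∉X

  fragment-escape : u ~ v → Fragment u v X → x ∈ X → y ∈ X → Fragment x y W → t ∉ X → t ∈ W → u ∈ W
  fragment-escape {u} {v} {X} {x} {y} {W} {t} u~v F x∈X y∈X FW t∉X t∈W =
    [ (λ t∈X → ⊥-elim (t∉X t∈X)) , (λ reaches-u → reaches-u t∈W) ]′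
      (connected-closed conn closed (inj₂ id) t)
    where
    outside-step : ∀ {p q} → p ∉ X → p ~ q → q ∈ W → p ∈ W
    outside-step {p} p∉X p~q q∈W with p ∈? W
    ... | yes p∈W = p∈W
    ... | no p∉W with Fragment.closed FW q∈W (~-sym p~q) p∉W
    ...   | inj₁ refl = ⊥-elim (p∉X x∈X)
    ...   | inj₂ refl = ⊥-elim (p∉X y∈X)
    u∉X : u ∉ X
    u∉X u∈X = proj₁ (Fragment.avoids F u∈X) refl
    closed : Closed (λ s → s ∈ X ⊎ (s ∈ W → u ∈ W))
    closed {p} {q} _ p~q with q ∈? X | p ∈? X
    ... | yes q∈X | _ = inj₁ q∈X
    ... | no q∉X | yes p∈X with Fragment.closed F p∈X p~q q∉X
    ...   | inj₁ refl = inj₂ id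
    ...   | inj₂ refl = inj₂ (outside-step u∉X u~v)
    closed {p} {q} (inj₁ p∈X)      p~q | no q∉X | no p∉X = ⊥-elim (p∉X p∈X)
    closed {p} {q} (inj₂ reaches-u) p~q | no q∉X | no p∉X = inj₂ (reaches-u ∘ outside-step p∉X p~q)

  fragment-inside : u ~ v → Fragment u v X → x ∈ X → y ∈ X → Fragment x y W → u ∉ W → W ⊂ X
  fragment-inside {X = X} {x} u~v F x∈X y∈X FW u∉W =
    W⊆X , x , x∈X , λ x∈W → proj₁ (Fragment.avoids FW x∈W) refl
    where
    W⊆X : ∀ {t} → t ∈ _ → t ∈ X
    W⊆X {t} t∈W with t ∈? X
    ... | yes t∈X = t∈X
    ... | no t∉X  = ⊥-elim (u∉W (fragment-escape u~v F x∈X y∈X FW t∉X t∈W))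

  fragment-shrinks : u ~ v → Fragment u v X → ∃[ x ] ∃[ y ] ∃[ W ] x ~ y × Fragment x y W × ∣ W ∣ < ∣ X ∣
  fragment-shrinks {u} u~v F with fragment-has-inner-edge u~v F
  ... | x , y , x∈X , y∈X , x~y with fragment-move u~v x~y F
  ...   | W , FW with u ∈? W
  ...     | no u∉W  = x , y , W , x~y , FW , p⊂q⇒∣p∣<∣q∣ (fragment-inside u~v F x∈X y∈X FW u∉W)
  ...     | yes u∈W = x , y , beyond W x y , x~y , fragment-complement FW ,
                      p⊂q⇒∣p∣<∣q∣ (fragment-inside u~v F x∈X y∈X (fragment-complement FW)
                                                (λ u∈B → proj₁ (∈-beyond⁻ u∈B) u∈W))

  no-fragment : u ~ v → ¬ Fragment u v X
  no-fragment {X = X} = descend X (<-wellFounded ∣ X ∣)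
    where
    descend : ∀ {u v} X → Acc _<_ ∣ X ∣ → u ~ v → ¬ Fragment u v X
    descend X (acc smaller) u~v F with fragment-shrinks u~v F
    ... | _ , _ , W , x~y , FW , W<X = descend W (smaller W<X) x~y FW

  route-avoiding-edge : ∀ {a b c d} → b ~ c → a ≢ b → a ≢ c → d ≢ b → d ≢ c →
                        Route (λ t → t ≢ b × t ≢ c) d a
  route-avoiding-edge {a} {b} {c} {d} b~c a≢b a≢c d≢b d≢c
    with explore (λ t → ¬? (t Finₚ.≟ b) ×-dec ¬? (t Finₚ.≟ c)) (a≢b , a≢c)
    where open Exploration G
  ... | R , E , closed with d ∈? R
  ...   | yes d∈R = route-mono allowed (routes d∈R)
    where open Exploration.Explored E
  ...   | no d∉R  = ⊥-elim (no-fragment b~c record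
    { inhabited = a , root
    ; proper    = d , ∈-beyond⁺ d∉R d≢b d≢c
    ; avoids    = allowed
    ; closed    = leave
    })
    where
    open Exploration.Explored E
    leave : x ∈ R → x ~ y → y ∉ R → OneOf y b c
    leave {y = y} x∈R x~y y∉R with y Finₚ.≟ b | y Finₚ.≟ c
    ... | yes y≡b | _       = inj₁ y≡b
    ... | no _    | yes y≡c = inj₂ y≡c
    ... | no y≢b  | no y≢c  = ⊥-elim (y∉R (closed x∈R x~y (y≢b , y≢c)))

module ShortPathsClose
  (G : Graph) (conn : Connected G) (et : EdgeTransitive G) (not-star : ¬ IsStar G) where
  open GraphBasics G
  open MinimumDegree G conn et not-star
  open EdgeEndsDoNotSeparate G conn et not-star
  open Paths G

  closes₃ : (P : Path G 3) → ClosesToCycle P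
  closes₃ P = _ , C , on-C , edges-on-C
    where
    a b c d : V
    a = vtx P 0F
    b = vtx P 1F
    c = vtx P 2F
    d = vtx P 3F
    r : Route (λ t → t ≢ b × t ≢ c) d a
    r = route-avoiding-edge (steps P 1F) (path-distinct P λ ()) (path-distinct P λ ())
                                         (path-distinct P λ ()) (path-distinct P λ ())
    open Route r
    c-then-r : Path G (ℕ.suc length)
    c-then-r = prepend c path (subst (c ~_) (sym starts) (steps P 2F)) (proj₂ ∘ within)
    fresh-b : ∀ k → vtx c-then-r k ≢ b
    fresh-b 0F      = path-distinct P λ ()
    fresh-b (suc k) = proj₁ (within k)
    Q : Path G (ℕ.suc (ℕ.suc length))
    Q = prepend b c-then-r (steps P 1F) fresh-b
    C : Cycle G (ℕ.suc (ℕ.suc (ℕ.suc length)))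
    C = close-path Q (s≤s (s≤s z≤n)) (subst (_~ b) (sym ends) (steps P 0F))
    on-C : ∀ k → ∃[ j ] cvtx C j ≡ vtx P k
    on-C 0F = fromℕ _ , ends
    on-C 1F = 0F , refl
    on-C 2F = 1F , refl
    on-C 3F = 2F , starts
    edges-on-C : ∀ i → CycleEdge C (vtx P (inject₁ i)) (vtx P (suc i))
    edges-on-C 0F = fromℕ _ , 0F , cycSucc-fromℕ , inj₁ (ends , refl)
    edges-on-C 1F = cycle-edge C (cycSucc-inject₁ 0F)
    edges-on-C 2F = 1F , 2F , cycSucc-inject₁ 1F , inj₁ (refl , starts)

  closes₂ : (P : Path G 2) → ClosesToCycle P
  closes₂ P with vtx P 2F ~? vtx P 0F
  ... | yes last~first = path-closes P ℕₚ.≤-refl last~first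
  ... | no last≁first with another-neighbour (vtx P 0F) (vtx P 1F)
  ...   | w , first~w , w≢1 = prepend-closes P w~P fresh (closes₃ (prepend w P w~P fresh))
    where
    w~P : w ~ vtx P 0F
    w~P = ~-sym first~w
    fresh : ∀ k → vtx P k ≢ w
    fresh 0F refl = ~-irrefl first~w
    fresh 1F e    = w≢1 (sym e)
    fresh 2F refl = last≁first (~-sym first~w)

  closes₁ : (P : Path G 1) → ClosesToCycle P
  closes₁ P with another-neighbour (vtx P 0F) (vtx P 1F)
  ... | w , first~w , w≢1 = prepend-closes P w~P fresh (closes₂ (prepend w P w~P fresh))
    where
    w~P : w ~ vtx P 0F
    w~P = ~-sym first~w
    fresh : ∀ k → vtx P k ≢ w
    fresh 0F refl = ~-irrefl first~w
    fresh 1F e    = w≢1 (sym e)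

  closes₀ : (P : Path G 0) → ClosesToCycle P
  closes₀ P with another-neighbour (vtx P 0F) (vtx P 0F)
  ... | w , first~w , _ = prepend-closes P w~P fresh (closes₁ (prepend w P w~P fresh))
    where
    w~P : w ~ vtx P 0F
    w~P = ~-sym first~w
    fresh : ∀ k → vtx P k ≢ w
    fresh 0F refl = ~-irrefl first~w

  short-paths-close : ∀ ℓ → ℓ ≤ 3 → (P : Path G ℓ) → ClosesToCycle P
  short-paths-close 0 _ = closes₀
  short-paths-close 1 _ = closes₁
  short-paths-close 2 _ = closes₂
  short-paths-close 3 _ = closes₃
  short-paths-close (ℕ.suc (ℕ.suc (ℕ.suc (ℕ.suc _)))) (s≤s (s≤s (s≤s ())))

-- Doubled cycles

module Twins (G : Graph) where
  open GraphBasics G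

  twins-confine-cycle : ∀ {L} (C : Cycle G L) {b₀ b₁ l r} → b₀ ≢ b₁ →
                        NeighboursAmong b₀ l r → NeighboursAmong b₁ l r →
                        (∃[ i ] cvtx C i ≡ b₀) → (∃[ i ] cvtx C i ≡ b₁) →
                        ∀ j → cvtx C j ≡ b₀ ⊎ cvtx C j ≡ b₁ ⊎ OneOf (cvtx C j) l r
  twins-confine-cycle {ℕ.zero}  C _ _ _ (() , _) _
  twins-confine-cycle {ℕ.suc M} C {b₀} {b₁} {l} {r} b₀≢b₁ N₀ N₁ (i₀ , e₀) (i₁ , e₁) =
    next-orbit S S-next (inj₁ e₀)
    where
    cv : Fin (ℕ.suc M) → V
    cv = cvtx C
    to-next : ∀ i → cv i ~ cv (next i)
    to-next i = csteps C i (next i) (cycSucc-next i)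
    to-prev : ∀ i → cv i ~ cv (prev i)
    to-prev i = ~-sym (subst (λ h → cv (prev i) ~ cv h) (next-prev i) (to-next (prev i)))
    flanks : ∀ {i b} → cv i ≡ b → NeighboursAmong b l r →
             ∀ {j} → OneOf (cv j) l r → j ≡ prev i ⊎ j ≡ next i
    flanks {i} refl N lr with oneOf-cover (N (to-prev i)) (N (to-next i))
                                          (prev≢next (ℕₚ.≤-pred (len≥3 C)) i ∘ cinj C) lr
    ... | inj₁ e = inj₁ (cinj C e)
    ... | inj₂ e = inj₂ (cinj C e)
    S : Fin (ℕ.suc M) → Set
    S j = cv j ≡ b₀ ⊎ cv j ≡ b₁ ⊎ OneOf (cv j) l r
    S-next : ∀ {j} → S j → S (next j)
    S-next {j} (inj₁ refl)        = inj₂ (inj₂ (N₀ (to-next j)))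
    S-next {j} (inj₂ (inj₁ refl)) = inj₂ (inj₂ (N₁ (to-next j)))
    S-next {j} (inj₂ (inj₂ lr)) with flanks e₀ N₀ lr | flanks e₁ N₁ lr
    ... | inj₁ refl | _         = inj₁ (subst (λ h → cv h ≡ b₀) (sym (next-prev i₀)) e₀)
    ... | inj₂ _    | inj₁ refl = inj₂ (inj₁ (subst (λ h → cv h ≡ b₁) (sym (next-prev i₁)) e₁))
    ... | inj₂ j≡i₀⁺ | inj₂ j≡i₁⁺ = ⊥-elim (b₀≢b₁ (trans (sym e₀) (trans (cong cv i₀≡i₁) e₁)))
      where
      i₀≡i₁ : i₀ ≡ i₁
      i₀≡i₁ = trans (sym (prev-next i₀)) (trans (cong prev (trans (sym j≡i₀⁺) j≡i₁⁺)) (prev-next i₁))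

module EnumeratedGraph {Vtx : Set} {m : ℕ} (enumeration : Fin m ↔ Vtx) (adj : Vtx → Vtx → Bool)
                       (adj-sym : ∀ a b → adj a b ≡ adj b a) (adj-irr : ∀ a → adj a a ≡ false) where
  open Inverse enumeration using (to; from; strictlyInverseˡ; strictlyInverseʳ)

  graph : Graph
  graph = record
    { n     = m
    ; E     = λ i j → adj (to i) (to j)
    ; E-sym = λ i j → adj-sym (to i) (to j)
    ; E-irr = adj-irr ∘ to
    }

  index : Vtx → Fin m
  index = from

  vertex : Fin m → Vtx
  vertex = to

  index-vertex : ∀ i → index (vertex i) ≡ i
  index-vertex = strictlyInverseʳ

  adj⇒Adj : ∀ {a b} → adj a b ≡ true → Adj graph (index a) (index b)
  adj⇒Adj {a} {b} = trans (cong₂ adj (strictlyInverseˡ a) (strictlyInverseˡ b))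

  index-injective : ∀ {a b} → index a ≡ index b → a ≡ b
  index-injective {a} {b} e = trans (sym (strictlyInverseˡ a)) (trans (cong to e) (strictlyInverseˡ b))

  Adj⇒adj : ∀ {a j} → Adj graph (index a) j → adj a (vertex j) ≡ true
  Adj⇒adj {a} = trans (cong (λ h → adj h _) (sym (strictlyInverseˡ a)))

  Symmetry : Set
  Symmetry = Σ (Vtx ↔ Vtx) λ σ → ∀ a b → adj (Inverse.to σ a) (Inverse.to σ b) ≡ adj a b

  act : Symmetry → Vtx → Vtx
  act σ = Inverse.to (proj₁ σ)

  infixr 9 _∘ˢ_
  _∘ˢ_ : Symmetry → Symmetry → Symmetry
  (σ , σ-adj) ∘ˢ (τ , τ-adj) = σ ↔-∘ τ , λ a b → trans (σ-adj _ _) (τ-adj a b)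

  lift : Symmetry → Aut graph
  lift (σ , σ-adj) = ↔-sym enumeration ↔-∘ (σ ↔-∘ enumeration) , λ i j →
    sym (trans (cong₂ adj (strictlyInverseˡ _) (strictlyInverseˡ _)) (σ-adj (to i) (to j)))

module DoubledCycle (M : ℕ) where

  N : ℕ
  N = ℕ.suc M

  -- The edge {y, next y} of the cycle on Fin N is replaced by the paths y – mid s y – next y.
  data Vertex : Set where
    node : Fin N → Vertex
    mid  : Bool → Fin N → Vertex

  Ends : Fin N → Fin N → Set
  Ends x y = x ≡ y ⊎ x ≡ next y

  ends? : ∀ x y → Dec (Ends x y)
  ends? x y = (x Finₚ.≟ y) ⊎-dec (x Finₚ.≟ next y)

  adj : Vertex → Vertex → Bool
  adj (node x)  (mid _ y) = does (ends? x y)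
  adj (mid _ y) (node x)  = does (ends? x y)
  adj (node _)  (node _)  = false
  adj (mid _ _) (mid _ _) = false

  adj-sym : ∀ a b → adj a b ≡ adj b a
  adj-sym (node _)  (node _)  = refl
  adj-sym (node _)  (mid _ _) = refl
  adj-sym (mid _ _) (node _)  = refl
  adj-sym (mid _ _) (mid _ _) = refl

  adj-irr : ∀ a → adj a a ≡ false
  adj-irr (node _)  = refl
  adj-irr (mid _ _) = refl

  vertex-code : (Fin 3 × Fin N) ↔ Vertex
  vertex-code = mk↔ₛ′ decode encode decode-encode encode-decode
    where
    decode : Fin 3 × Fin N → Vertex
    decode (0F , k) = node k
    decode (1F , k) = mid false k
    decode (2F , k) = mid true k
    encode : Vertex → Fin 3 × Fin N
    encode (node k)      = 0F , k
    encode (mid false k) = 1F , k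
    encode (mid true k)  = 2F , k
    decode-encode : ∀ v → decode (encode v) ≡ v
    decode-encode (node _)      = refl
    decode-encode (mid false _) = refl
    decode-encode (mid true _)  = refl
    encode-decode : ∀ c → encode (decode c) ≡ c
    encode-decode (0F , _) = refl
    encode-decode (1F , _) = refl
    encode-decode (2F , _) = refl

  open EnumeratedGraph (vertex-code ↔-∘ *↔×) adj adj-sym adj-irr public
  open GraphBasics graph using (_~_; NeighboursAmong; _++ʷ_; connected-from-root)

  relabel : (g h : Fin N ↔ Fin N) → (∀ x y → Ends (Inverse.to g x) (Inverse.to h y) ⇔ Ends x y) →
            Symmetry
  relabel g h ends = mk↔ₛ′ (apply (to g) (to h)) (apply (from g) (from h))
                           (apply-inverse (strictlyInverseˡ g) (strictlyInverseˡ h))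
                           (apply-inverse (strictlyInverseʳ g) (strictlyInverseʳ h)) , preserves
    where
    open Inverse using (to; from; strictlyInverseˡ; strictlyInverseʳ)
    apply : (Fin N → Fin N) → (Fin N → Fin N) → Vertex → Vertex
    apply f f′ (node x)  = node (f x)
    apply f f′ (mid s y) = mid s (f′ y)
    apply-inverse : ∀ {f f′ k k′} → (∀ x → f (k x) ≡ x) → (∀ y → f′ (k′ y) ≡ y) →
                    ∀ v → apply f f′ (apply k k′ v) ≡ v
    apply-inverse fk _   (node x)  = cong node (fk x)
    apply-inverse _  fk′ (mid s y) = cong (mid s) (fk′ y)
    preserves : ∀ a b → adj (apply (to g) (to h) a) (apply (to g) (to h) b) ≡ adj a b
    preserves (node x)  (mid _ y) = does-⇔ (ends x y) (ends? _ _) (ends? x y)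
    preserves (mid _ y) (node x)  = does-⇔ (ends x y) (ends? _ _) (ends? x y)
    preserves (node _)  (node _)  = refl
    preserves (mid _ _) (mid _ _) = refl

  swap-colours : Symmetry
  swap-colours = mk↔ₛ′ swap swap involutive involutive , preserves
    where
    swap : Vertex → Vertex
    swap (node x)  = node x
    swap (mid s y) = mid (not s) y
    involutive : ∀ v → swap (swap v) ≡ v
    involutive (node x)  = refl
    involutive (mid s y) = cong (λ s → mid s y) (not-involutive s)
    preserves : ∀ a b → adj (swap a) (swap b) ≡ adj a b
    preserves (node _)  (node _)  = refl
    preserves (node _)  (mid _ _) = refl
    preserves (mid _ _) (node _)  = refl
    preserves (mid _ _) (mid _ _) = refl

  CommutesWithNext : Fin N ↔ Fin N → Set
  CommutesWithNext g = ∀ k → Inverse.to g (next k) ≡ next (Inverse.to g k)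

  rotation : (g : Fin N ↔ Fin N) → CommutesWithNext g → Symmetry
  rotation g commutes = relabel g g λ x y → mk⇔
    (λ { (inj₁ e) → inj₁ (↔-injective g e)
       ; (inj₂ e) → inj₂ (↔-injective g (trans e (sym (commutes y)))) })
    (λ { (inj₁ refl) → inj₁ refl ; (inj₂ refl) → inj₂ (commutes y) })

  rotation-to-zero : ∀ y → Σ (Fin N ↔ Fin N) λ g → CommutesWithNext g × Inverse.to g y ≡ 0F
  rotation-to-zero = <-weakInduction _ (↔-id _ , (λ _ → refl) , refl) λ j (g , commutes , gj≡0) →
    g ↔-∘ backwards , (λ k → trans (cong (Inverse.to g) (backwards-commutes k)) (commutes (prev k))) ,
    gj≡0
    where
    backwards : Fin N ↔ Fin N
    backwards = mk↔ₛ′ prev next prev-next next-prev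
    backwards-commutes : ∀ k → prev (next k) ≡ next (prev k)
    backwards-commutes k = trans (prev-next k) (sym (next-prev k))

  reflection : Symmetry
  reflection = relabel (mk↔ₛ′ opposite opposite Finₚ.opposite-involutive Finₚ.opposite-involutive)
                       (mk↔ₛ′ mirror mirror mirror-involutive mirror-involutive) ends
    where
    -- opposite maps the segment {y, next y} onto {prev (opposite y), opposite y} (opposite-next).
    mirror : Fin N → Fin N
    mirror = prev ∘ opposite
    mirror-involutive : ∀ y → mirror (mirror y) ≡ y
    mirror-involutive y = begin
      prev (opposite (prev (opposite y)))  ≡⟨ cong (prev ∘ opposite) (opposite-next y) ⟨
      prev (opposite (opposite (next y)))  ≡⟨ cong prev (Finₚ.opposite-involutive (next y)) ⟩
      prev (next y)                        ≡⟨ prev-next y ⟩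
      y                                    ∎
    opposite-injective : ∀ {x y : Fin N} → opposite x ≡ opposite y → x ≡ y
    opposite-injective {x} {y} e =
      trans (sym (Finₚ.opposite-involutive x)) (trans (cong opposite e) (Finₚ.opposite-involutive y))
    ends : ∀ x y → Ends (opposite x) (mirror y) ⇔ Ends x y
    ends x y = mk⇔
      (λ { (inj₁ e) → inj₂ (opposite-injective (trans e (sym (opposite-next y))))
         ; (inj₂ e) → inj₁ (opposite-injective (trans e (next-prev (opposite y)))) })
      (λ { (inj₁ refl) → inj₂ (sym (next-prev (opposite x))) ; (inj₂ refl) → inj₁ (opposite-next y) })

  Carried : Symmetry → Vertex → Vertex → Set
  Carried σ a b = act σ a ≡ node 0F × act σ b ≡ mid false 0F

  carry-aligned : ∀ s y → Σ Symmetry λ σ → Carried σ (node y) (mid s y)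
  carry-aligned s y with rotation-to-zero y
  ... | g , commutes , gy≡0 = recoloured s
    where
    ρ : Symmetry
    ρ = rotation g commutes
    recoloured : ∀ s → Σ Symmetry λ σ → Carried σ (node y) (mid s y)
    recoloured false = ρ , cong node gy≡0 , cong (mid false) gy≡0
    recoloured true  = ρ ∘ˢ swap-colours , cong node gy≡0 , cong (mid false) gy≡0

  carry-edge : ∀ a b → adj a b ≡ true → Σ Symmetry λ σ → Carried σ a b ⊎ Carried σ b a
  carry-edge (node x) (mid s y) x~y with does-true (ends? x y) x~y
  ... | inj₁ refl = let σ , carried = carry-aligned s x in σ , inj₁ carried
  ... | inj₂ refl = let σ , node↦ , mid↦ = carry-aligned s (prev (opposite y)) in
                    σ ∘ˢ reflection , inj₁ (trans (cong (act σ ∘ node) (opposite-next y)) node↦ , mid↦)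
  carry-edge (mid s y) (node x) y~x with carry-edge (node x) (mid s y) y~x
  ... | σ , carried = σ , ⊎-swap carried

  D : Graph
  D = graph

  D-edge-transitive : EdgeTransitive D
  D-edge-transitive = Automorphisms.edge-transitive-via D (index (node 0F)) (index (mid false 0F)) carry
    where
    carry : ∀ {i j} → Adj D i j →
            Σ (Aut D) λ φ → Automorphisms.Carries D φ i j (index (node 0F)) (index (mid false 0F))
    carry {i} {j} i~j with carry-edge (vertex i) (vertex j) i~j
    ... | σ , inj₁ (a↦ , b↦) = lift σ , inj₁ (cong index a↦ , cong index b↦)
    ... | σ , inj₂ (b↦ , a↦) = lift σ , inj₂ (cong index a↦ , cong index b↦)

  node~mid : ∀ s y → index (node y) ~ index (mid s y)
  node~mid s y = adj⇒Adj {node y} {mid s y} (dec-true (ends? y y) (inj₁ refl))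

  mid~next-node : ∀ s y → index (mid s y) ~ index (node (next y))
  mid~next-node s y = adj⇒Adj {mid s y} {node (next y)} (dec-true (ends? (next y) y) (inj₂ refl))

  mid~node : ∀ s y → index (mid s y) ~ index (node y)
  mid~node s y = adj⇒Adj {mid s y} {node y} (dec-true (ends? y y) (inj₁ refl))

  node→mid : ∀ s y → Walk D (index (node y)) (index (mid s y))
  node→mid s y = step (node~mid s y) here

  mid→next-node : ∀ s y → Walk D (index (mid s y)) (index (node (next y)))
  mid→next-node s y = step (mid~next-node s y) here

  mid-neighbours : ∀ s y → NeighboursAmong (index (mid s y)) (index (node y)) (index (node (next y)))
  mid-neighbours s y {t} e =
    ⊎-map (index-at t) (index-at t) (mid-adjacent (vertex t) (Adj⇒adj {mid s y} {t} e))
    where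
    index-at : ∀ t {v} → vertex t ≡ v → t ≡ index v
    index-at t e = trans (sym (index-vertex t)) (cong index e)
    mid-adjacent : ∀ v → adj (mid s y) v ≡ true → OneOf v (node y) (node (next y))
    mid-adjacent (node x) e with does-true (ends? x y) e
    ... | inj₁ refl = inj₁ refl
    ... | inj₂ refl = inj₂ refl

  D-connected : Connected D
  D-connected = connected-from-root (index (node 0F)) λ i →
    subst (Walk D _) (index-vertex i) (walk-to (vertex i))
    where
    walk-to-node : ∀ k → Walk D (index (node 0F)) (index (node k))
    walk-to-node = <-weakInduction _ here λ j w →
      subst (λ k → Walk D _ (index (node k))) (next-inject₁ j)
            (w ++ʷ node→mid false (inject₁ j) ++ʷ mid→next-node false (inject₁ j))
    walk-to : ∀ v → Walk D (index (node 0F)) (index v)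
    walk-to (node k)  = walk-to-node k
    walk-to (mid s k) = walk-to-node k ++ʷ node→mid s k

  advance : Vertex → Vertex
  advance (node x)      = mid false x
  advance (mid false y) = node (next y)
  advance (mid true y)  = node y

  advance-adjacent : ∀ v → index v ~ index (advance v)
  advance-adjacent (node x)      = node~mid false x
  advance-adjacent (mid false y) = mid~next-node false y
  advance-adjacent (mid true y)  = mid~node true y

  zigzag : ℕ → Vertex
  zigzag ℕ.zero    = mid true 0F
  zigzag (ℕ.suc t) = advance (zigzag t)

  rank : Vertex → ℕ
  rank (mid true y)  = toℕ y + toℕ y
  rank (node x)      = ℕ.suc (toℕ x + toℕ x)
  rank (mid false y) = ℕ.suc (ℕ.suc (toℕ y + toℕ y))

  rank-advance : ∀ v → rank v < M → rank (advance v) ≡ ℕ.suc (rank v)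
  rank-advance (node x)      _     = refl
  rank-advance (mid true y)  _     = refl
  rank-advance (mid false y) small = begin
    ℕ.suc (toℕ (next y) + toℕ (next y))  ≡⟨ cong (λ k → ℕ.suc (k + k)) (toℕ-next y M≢y) ⟩
    ℕ.suc (ℕ.suc (toℕ y) + ℕ.suc (toℕ y)) ≡⟨ cong (ℕ.suc ∘ ℕ.suc) (ℕₚ.+-suc (toℕ y) (toℕ y)) ⟩
    ℕ.suc (ℕ.suc (ℕ.suc (toℕ y + toℕ y))) ∎
    where
    y<M : toℕ y < M
    y<M = ℕₚ.≤-trans (s≤s (ℕₚ.m≤m+n (toℕ y) (toℕ y))) (ℕₚ.≤-trans (ℕₚ.n≤1+n _) (ℕₚ.<⇒≤ small))
    M≢y : M ≢ toℕ y
    M≢y M≡y = ℕₚ.<-irrefl (sym M≡y) y<M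

  rank-zigzag : ∀ t → t ≤ M → rank (zigzag t) ≡ t
  rank-zigzag ℕ.zero    _   = refl
  rank-zigzag (ℕ.suc t) t<M = trans (rank-advance (zigzag t) (subst (_< M) (sym IH) t<M)) (cong ℕ.suc IH)
    where
    IH : rank (zigzag t) ≡ t
    IH = rank-zigzag t (ℕₚ.<⇒≤ t<M)

  zigzag-path : ∀ ℓ → ℓ ≤ M → Path D ℓ
  zigzag-path ℓ ℓ≤M = record
    { vtx   = λ i → index (zigzag (toℕ i))
    ; inj   = λ {i} {j} e → Finₚ.toℕ-injective (begin
        toℕ i                    ≡⟨ rank-zigzag (toℕ i) (bound i) ⟨
        rank (zigzag (toℕ i))    ≡⟨ cong rank (index-injective {zigzag (toℕ i)} {zigzag (toℕ j)} e) ⟩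
        rank (zigzag (toℕ j))    ≡⟨ rank-zigzag (toℕ j) (bound j) ⟩
        toℕ j                    ∎)
    ; steps = λ i → subst (λ t → index (zigzag t) ~ index (zigzag (ℕ.suc (toℕ i))))
                          (sym (Finₚ.toℕ-inject₁ i)) (advance-adjacent (zigzag (toℕ i)))
    }
    where
    bound : ∀ (i : Fin (ℕ.suc ℓ)) → toℕ i ≤ M
    bound i = ℕₚ.≤-trans (ℕₚ.≤-pred (Finₚ.toℕ<n i)) ℓ≤M

  zigzag-does-not-close : ∀ ℓ (ℓ≤M : ℓ ≤ M) → 4 ≤ ℓ → ¬ ClosesToCycle (zigzag-path ℓ ℓ≤M)
  zigzag-does-not-close ℓ ℓ≤M (s≤s (s≤s (s≤s (s≤s _)))) (L , C , on-C , _) =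
    [ off {0F} (λ ()) , [ off {2F} (λ ()) , [ off {1F} (λ ()) , off {3F} (λ ()) ]′ ]′ ]′ (confined j)
    where
    P : Path D ℓ
    P = zigzag-path ℓ ℓ≤M
    distinct : ∀ {i k} → i ≢ k → vtx P i ≢ vtx P k
    distinct = Paths.path-distinct D P
    confined : ∀ j → cvtx C j ≡ vtx P 0F ⊎ cvtx C j ≡ vtx P 2F ⊎ OneOf (cvtx C j) (vtx P 1F) (vtx P 3F)
    confined = Twins.twins-confine-cycle D C (distinct {0F} {2F} λ ())
                                         (mid-neighbours true 0F) (mid-neighbours false 0F) (on-C 0F) (on-C 2F)
    j : Fin L
    j = proj₁ (on-C 4F)
    off : ∀ {k} → 4F ≢ k → cvtx C j ≢ vtx P k
    off {k} 4≢k C-j≡k = distinct {4F} {k} 4≢k (trans (sym (proj₂ (on-C 4F))) C-j≡k)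

doubled-cycles-non-isomorphic : ∀ {M M′} → Iso (DoubledCycle.D M) (DoubledCycle.D M′) → M ≡ M′
doubled-cycles-non-isomorphic (φ , _) = ℕₚ.suc-injective (ℕₚ.*-cancelˡ-≡ _ _ 3 (↔⇒≡ φ))

theorem1p8 :
    (∀ (G : Graph) → Connected G → EdgeTransitive G → ¬ IsStar G →
      ∀ (ℓ : ℕ) → ℓ ≤ 3 → (P : Path G ℓ) → ClosesToCycle P)
    ×
    (∀ (ℓ : ℕ) → 4 ≤ ℓ →
      Σ (ℕ → Graph) λ F → ((∀ (i j : ℕ) → ¬ i ≡ j → ¬ Iso (F i) (F j)) ×
              (∀ (i : ℕ) → Connected (F i) × EdgeTransitive (F i) ×
                 Σ (Path (F i) ℓ) λ P → (¬ ClosesToCycle {F i} {ℓ} P))))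
theorem1p8 =
    (λ G conn et not-star → ShortPathsClose.short-paths-close G conn et not-star)
  , λ ℓ 4≤ℓ →
        (λ i → DoubledCycle.D (ℓ + i))
      , (λ i j i≢j iso → i≢j (ℕₚ.+-cancelˡ-≡ ℓ i j (doubled-cycles-non-isomorphic iso)))
      , λ i → let open DoubledCycle (ℓ + i) ; ℓ≤M = ℕₚ.m≤m+n ℓ i in
              D-connected , D-edge-transitive , zigzag-path ℓ ℓ≤M , zigzag-does-not-close ℓ ℓ≤M 4≤ℓ
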